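{- Every projection of a sunword is a sunword; that is, the class of sunwords is closed under projection.
   Context: Words over a finite alphabet $\Sigma$ with special symbol $\epsilon$; $x^k$ is $k$ copies of $x$. The pattern $\pi(w)$ is obtained by deleting occurrences of $\epsilon\epsilon$ (each maximal run $\epsilon^k$ becomes $\epsilon$ if $k$ odd, vanishes if $k$ even). $v\sim w$ if $w$ arises from $v$ by cyclic shift and/or reversal; $u\approx v$ iff $\pi(u)\sim\pi(v)$; the cyclic word $[w]$ is the $\approx$-class of $w$. Multisun: a diamond-free (no induced $K_4$ minus an edge) graph of odd order whose maximal cliques of size 2 span a Hamiltonian cycle (the rim); other maximal cliques (inscribed cliques) consist of pairwise nonconsecutive rim vertices. A sub-multisun deletes the edge sets of some, but not all, inscribed cliques. For inscribed cliques $A,B$, an $AB$-path is a rim subpath with one end in $A$, the other in $B$, no interior vertex in an inscribed clique; $A$-path = $AA$-path; $Av$-path = $AB$-path ending at $v\in B$. N-conditions: (N1) $A$-paths have an even number $\ge4$ of vertices; (N2) inscribed cliques are odd; (N3) all inscribed cliques share one vertex $\xi$ and are otherwise disjoint; (N4) $A\xi$-paths have an even number of vertices; (N5) $AB$-paths with $A\ne B$ have an odd number of vertices. A sunoid is a multisun such that it and all its sub-multisuns satisfy the N-conditions. For a sunoid $G$, label rim vertices $\sigma$ if in more than one inscribed clique, $x$ if only in the inscribed clique $X$ (distinct letters for distinct cliques), $\epsilon$ otherwise; reading labels around the rim gives $w_G$; a sunword is a cyclic word $[w_G]$ for a sunoid $G$. Its alphabet $\Sigma$ consists of the labels used; $\sigma\in\Sigma$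 iff there are at least two inscribed cliques. Projection: let $W=[w]$ be a sunword whose alphabet contains $p\ge2$ letters other than $\epsilon,\sigma$, and let $\{x_1,\dots,x_q\}$ be a set of such letters with $q<p$. The word $w|_{x_1=\epsilon,\dots,x_q=\epsilon}$ is obtained from $w$ by replacing every occurrence of $x_1,\dots,x_q$ by $\epsilon$ and, if $q=p-1$, also replacing $\sigma$ by the unique remaining letter $y\notin\{\epsilon,\sigma,x_1,\dots,x_q\}$. The projection $W|_{x_1=\epsilon,\dots,x_q=\epsilon}=[w|_{x_1=\epsilon,\dots,x_q=\epsilon}]$ (independent of the representative), a cyclic word on $\Sigma\setminus\{x_1,\dots,x_q\}$ (with $\sigma$ removed when $q=p-1$). -}

module Defs where

open import Data.Nat using (ℕ; zero; suc; _+_; _≤_; _<_; _≟_; _%_; NonZero)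
open import Data.Nat.DivMod using (m%n<n)
open import Data.Fin using (Fin; fromℕ<; toℕ)
open import Data.Fin.Subset using (Subset; _∈_; _∉_; ⁅_⁆; _∪_; ∣_∣)
open import Data.Vec using (Vec)
import Data.Vec as Vec
open import Data.List using (List; []; _∷_; _++_; _∷ʳ_; reverse; map; filter; length; deduplicate; mapMaybe)
open import Data.List.Relation.Unary.Any using (Any)
import Data.List.Relation.Unary.All
import Relation.Nullary
open import Data.List.Membership.DecPropositional using ()
open import Data.Maybe using (Maybe; just; nothing)
open import Data.Product using (Σ; ∃; ∃-syntax; _×_; _,_)
open import Data.Sum using (_⊎_)
open import Data.Empty using (⊥)
open import Relation.Nullary using (¬_; yes; no)
open import Relation.Binary.PropositionalEquality using (_≡_; _≢_)
open import Function.Definitions using (Bijective)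
import Data.List.Membership.DecPropositional as DecMem

Even : ℕ → Set
Even n = n % 2 ≡ 0

Odd : ℕ → Set
Odd n = n % 2 ≡ 1

data Sym : Set where
  ε   : Sym
  σ   : Sym
  ltr : ℕ → Sym

infix 4 _≈_
data _≈_ : List Sym → List Sym → Set where
  ≈-refl  : ∀ {u} → u ≈ u
  ≈-sym   : ∀ {u v} → u ≈ v → v ≈ u
  ≈-trans : ∀ {u v t} → u ≈ v → v ≈ t → u ≈ t
  ≈-rot   : ∀ {x u} → (x ∷ u) ≈ (u ∷ʳ x)
  ≈-rev   : ∀ {u} → u ≈ reverse u
  ≈-εε    : ∀ {u v} → (u ++ ε ∷ ε ∷ v) ≈ (u ++ v)

Graph : ℕ → Set₁
Graph n = Fin n → Fin n → Set

module _ {n : ℕ} (G : Graph n) where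

  IsClique : Subset n → Set
  IsClique C = ∀ u v → u ∈ C → v ∈ C → u ≢ v → G u v

  IsMaxClique : Subset n → Set
  IsMaxClique C = IsClique C × (∀ v → v ∉ C → ¬ (∀ u → u ∈ C → G u v))

  Inscribed : Subset n → Set
  Inscribed C = IsMaxClique C × ∣ C ∣ ≢ 2

  DiamondFree : Set
  DiamondFree = ¬ (Σ (Fin n) λ a → Σ (Fin n) λ b → Σ (Fin n) λ c → Σ (Fin n) λ d →
      a ≢ b × a ≢ c × a ≢ d × b ≢ c × b ≢ d × c ≢ d ×
      G a b × G a c × G a d × G b c × G b d × ¬ G c d)

shift : ∀ {n} → Fin n → ℕ → Fin n
shift {suc m} i j = fromℕ< (m%n<n (toℕ i + j) (suc m))

-- Multisuns.  A rim is given by a bijection f : positions → vertices;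
-- rim vertices f i and f (shift i 1) are consecutive.

record Multisun {n : ℕ} (G : Graph n) (f : Fin n → Fin n) : Set where
  field
    odd-order   : Odd n
    three≤n     : 3 ≤ n
    symmetric   : ∀ u v → G u v → G v u
    irreflexive : ∀ u → ¬ G u u
    diamondFree : DiamondFree G
    f-bij       : Bijective _≡_ _≡_ f
    rim₁ : ∀ C → IsMaxClique G C → ∣ C ∣ ≡ 2 → ∃[ i ] C ≡ ⁅ f i ⁆ ∪ ⁅ f (shift i 1) ⁆
    rim₂ : ∀ i → IsMaxClique G (⁅ f i ⁆ ∪ ⁅ f (shift i 1) ⁆)
    nonconsec : ∀ C → Inscribed G C → ∀ i → ¬ (f i ∈ C × f (shift i 1) ∈ C)

deleteCliques : ∀ {n} → Graph n → List (Subset n) → Graph n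
deleteCliques G ds u v = G u v × ¬ Any (λ C → u ∈ C × v ∈ C) ds

-- N-conditions (for a graph G with rim f).
-- A rim subpath starts at position i and runs k steps forward
-- (1 ≤ k < n); it has k+1 vertices, ends f i and f (shift i k).

module _ {n : ℕ} (G : Graph n) (f : Fin n → Fin n) where

  RimPath : Fin n → ℕ → Set
  RimPath i k = 1 ≤ k × k < n ×
    (∀ j → 1 ≤ j → j < k → ∀ C → Inscribed G C → f (shift i j) ∉ C)

  N1 : Set
  N1 = ∀ A → Inscribed G A → ∀ i k → RimPath i k →
       f i ∈ A → f (shift i k) ∈ A → Even (suc k) × 4 ≤ suc k

  N2 : Set
  N2 = ∀ A → Inscribed G A → Odd ∣ A ∣

  N3 : Fin n → Set
  N3 ξ = (∀ A → Inscribed G A → ξ ∈ A) ×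
         (∀ A B → Inscribed G A → Inscribed G B → A ≢ B → ∀ v → v ∈ A → v ∈ B → v ≡ ξ)

  N4 : Fin n → Set
  N4 ξ = ∀ A → Inscribed G A → ∀ i k → RimPath i k →
         (f i ∈ A × f (shift i k) ≡ ξ) ⊎ (f i ≡ ξ × f (shift i k) ∈ A) → Even (suc k)

  N5 : Set
  N5 = ∀ A B → Inscribed G A → Inscribed G B → A ≢ B → ∀ i k → RimPath i k →
       f i ∈ A → f i ∉ B → f (shift i k) ∈ B → f (shift i k) ∉ A → Odd (suc k)

  NConditions : Set
  NConditions = N1 × N2 × (∃[ ξ ] (N3 ξ × N4 ξ)) × N5

-- Sunoids: the multisun and all its sub-multisuns satisfy the
-- N-conditions.  A sub-multisun deletes the edge sets of a list ds of
-- inscribed cliques, not all of them (ds = [] gives G itself).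

record Sunoid {n : ℕ} (G : Graph n) (f : Fin n → Fin n) : Set where
  field
    multisun : Multisun G f
    subN : ∀ (ds : List (Subset n)) →
           Data.List.Relation.Unary.All.All (Inscribed G) ds →
           (∃[ C ] (Inscribed G C × ¬ Any (C ≡_) ds)) →
           NConditions (deleteCliques G ds) f

-- Labels: ℓ names inscribed cliques (injectively) by letters.

module _ {n : ℕ} (G : Graph n) (ℓ : Subset n → ℕ) where

  data Label (v : Fin n) : Sym → Set where
    lσ : ∀ A B → Inscribed G A → Inscribed G B → A ≢ B → v ∈ A → v ∈ B → Label v σ
    lx : ∀ X → Inscribed G X → v ∈ X → (∀ Y → Inscribed G Y → v ∈ Y → Y ≡ X) →
         Label v (ltr (ℓ X))
    lε : (∀ Y → Inscribed G Y → v ∉ Y) → Label v ε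

IsSunword : List Sym → Set₁
IsSunword w =
  Σ ℕ λ n → Σ (Graph n) λ G → Σ (Fin n → Fin n) λ f → Σ (Subset n → ℕ) λ ℓ →
  Σ (Vec Sym n) λ r →
    Sunoid G f ×
    (∀ A B → Inscribed G A → Inscribed G B → ℓ A ≡ ℓ B → A ≡ B) ×
    (∀ i → Label G ℓ (f i) (Vec.lookup r i)) ×
    Vec.toList r ≈ w

letterOf : Sym → Maybe ℕ
letterOf (ltr x) = just x
letterOf _       = nothing

letters : List Sym → List ℕ
letters w = deduplicate _≟_ (mapMaybe letterOf w)

numLetters : List Sym → ℕ
numLetters w = length (letters w)

open DecMem _≟_ using (_∈?_)

-- image of σ: the remaining letter y if q = p - 1 (σ otherwise)
sigmaImage : List ℕ → Sym
sigmaImage []      = σ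
sigmaImage (y ∷ _) = ltr y

projSym : List ℕ → Sym → Sym → Sym
projSym xs s ε       = ε
projSym xs s σ       = s
projSym xs s (ltr x) with x ∈? xs
... | yes _ = ε
... | no  _ = ltr x

project : List Sym → List ℕ → List Sym
project w xs with suc (length xs) ≟ numLetters w
... | yes _ = map (projSym xs (sigmaImage (filter (λ y → Relation.Nullary.¬? (y ∈? xs)) (letters w)))) w
... | no  _ = map (projSym xs σ) w

-- Realise w by a sunoid G and delete the edge sets of the inscribed cliques
-- named x₁, …, x_q.  By diamond-freeness no new maximal cliques appear, so the
-- result is a multisun whose inscribed cliques are exactly the surviving ones;
-- its sub-multisuns are sub-multisuns of G, hence it is again a sunoid.  Its
-- rim labels are the projected ones: private vertices of deleted cliques
-- become ε, and the vertex ξ shared by all cliques (N3) keeps σ unless a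
-- single clique survives, in which case it carries that clique's letter.
module Submission where

open import Defs
open import Data.Nat using (ℕ; zero; suc; _+_; _≤_; _<_; _≟_; _<?_; _%_)
open import Data.Nat.Properties
  using (≤-trans; ≤-pred; ≤-antisym; ≮⇒≥; ≤∧≢⇒<; <-irrefl; n<1+n; 1+n≢n; +-comm; m+n≤o⇒n≤o)
open import Data.Nat.DivMod using (m<n⇒m%n≡m; n%n≡0)
open import Data.Fin using (Fin; zero; suc; toℕ; fromℕ<)
import Data.Fin.Properties as FinP
open import Data.Fin.Subset using (Subset; ⁅_⁆; _∪_)
  renaming (_∈_ to _∈ₛ_; _∉_ to _∉ₛ_; _⊆_ to _⊆ₛ_)
import Data.Fin.Subset.Properties as SubsetP
open import Data.List using (List; []; _∷_; _++_; length; map; filter; mapMaybe)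
open import Data.List.Properties using (filter-notAll; map-++; reverse-map)
open import Data.List.Relation.Unary.All using (All; []; _∷_)
import Data.List.Relation.Unary.All as All
open import Data.List.Relation.Unary.All.Properties using (¬Any⇒All¬; ++⁺)
open import Data.List.Relation.Unary.Any using (Any; here; there)
import Data.List.Relation.Unary.Any as Any
open import Data.List.Relation.Unary.Any.Properties using (++⁺ˡ; ++⁺ʳ; ++⁻)
open import Data.List.Relation.Unary.Unique.Propositional using (Unique)
open import Data.List.Relation.Unary.AllPairs using (_∷_)
open import Data.List.Relation.Unary.Unique.DecPropositional.Properties using (deduplicate-!)
open import Data.List.Membership.Propositional using (_∈_; _∉_; find; lose)
open import Data.List.Membership.Propositional.Properties
  using (∈-filter⁺; ∈-filter⁻; ∈-deduplicate⁺; ∈-deduplicate⁻)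
import Data.List.Membership.DecPropositional as DecMembership
open import Data.List.Relation.Binary.Permutation.Propositional using (↭-sym)
open import Data.List.Relation.Binary.Permutation.Propositional.Properties
  using (∈-resp-↭; ∷↭∷ʳ; ↭-reverse; shifts)
open import Data.Vec using (Vec; lookup; toList)
import Data.Vec as Vec
open import Data.Vec.Properties using (lookup-map; toList-map)
open import Data.Vec.Membership.Propositional using () renaming (_∈_ to _∈ᵥ_)
open import Data.Vec.Membership.Propositional.Properties using (∈-lookup; ∈-toList⁺; ∈-toList⁻)
open import Data.Vec.Relation.Unary.Any using (index)
open import Data.Vec.Relation.Unary.Any.Properties using (lookup-index)
open import Data.Product using (∃; ∃₂; ∃-syntax; _×_; _,_; proj₁; proj₂)
open import Data.Sum using (inj₁; inj₂; [_,_]′)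
open import Data.Empty using (⊥; ⊥-elim)
open import Function using (_∘_; case_of_)
open import Function.Bundles using (_⇔_; mk⇔; Equivalence)
import Function.Properties.Equivalence as ⇔
open import Relation.Nullary using (¬_; ¬?; Dec; yes; no)
open import Relation.Nullary.Decidable using (_×-dec_; decidable-stable)
open import Relation.Binary.Definitions using (DecidableEquality)
open import Relation.Binary.PropositionalEquality using (_≡_; _≢_; refl; sym; trans; cong; subst)

open DecMembership _≟_ using (_∈?_)
open Equivalence using (to; from)

module _ {A : Set} (_≟ᴬ_ : DecidableEquality A) where
  open DecMembership _≟ᴬ_ using () renaming (_∈?_ to _∈ᴬ?_)

  unique-longer⇒∃∉ : ∀ {ys : List A} → Unique ys → ∀ xs → length xs < length ys →
                     ∃[ y ] (y ∈ ys × y ∉ xs)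
  unique-longer⇒∃∉ {y ∷ ys} (y∉ys ∷ ys!) xs |xs|<|ys| with y ∈ᴬ? xs
  ... | no y∉xs = y , here refl , y∉xs
  ... | yes y∈xs with unique-longer⇒∃∉ ys! (filter (λ z → ¬? (z ≟ᴬ y)) xs) shorter
    where
    shorter = ≤-trans (filter-notAll (λ z → ¬? (z ≟ᴬ y)) xs (lose y∈xs (λ y≢y → y≢y refl)))
                      (≤-pred |xs|<|ys|)
  ... | z , z∈ys , z∉xs′ =
    z , there z∈ys , λ z∈xs → z∉xs′ (∈-filter⁺ (λ z → ¬? (z ≟ᴬ y)) z∈xs (All.lookup y∉ys z∈ys ∘ sym))

∈-mapMaybe-letterOf⁺ : ∀ {x} w → ltr x ∈ w → x ∈ mapMaybe letterOf w
∈-mapMaybe-letterOf⁺ (_ ∷ w)     (here refl) = here refl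
∈-mapMaybe-letterOf⁺ (ε ∷ w)     (there p)   = ∈-mapMaybe-letterOf⁺ w p
∈-mapMaybe-letterOf⁺ (σ ∷ w)     (there p)   = ∈-mapMaybe-letterOf⁺ w p
∈-mapMaybe-letterOf⁺ (ltr _ ∷ w) (there p)   = there (∈-mapMaybe-letterOf⁺ w p)

∈-mapMaybe-letterOf⁻ : ∀ {x} w → x ∈ mapMaybe letterOf w → ltr x ∈ w
∈-mapMaybe-letterOf⁻ (ε ∷ w)     p           = there (∈-mapMaybe-letterOf⁻ w p)
∈-mapMaybe-letterOf⁻ (σ ∷ w)     p           = there (∈-mapMaybe-letterOf⁻ w p)
∈-mapMaybe-letterOf⁻ (ltr _ ∷ w) (here refl) = here refl
∈-mapMaybe-letterOf⁻ (ltr _ ∷ w) (there p)   = there (∈-mapMaybe-letterOf⁻ w p)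

∈-letters⁺ : ∀ {x} w → ltr x ∈ w → x ∈ letters w
∈-letters⁺ w = ∈-deduplicate⁺ _≟_ ∘ ∈-mapMaybe-letterOf⁺ w

∈-letters⁻ : ∀ {x} w → x ∈ letters w → ltr x ∈ w
∈-letters⁻ w = ∈-mapMaybe-letterOf⁻ w ∘ ∈-deduplicate⁻ _≟_ (mapMaybe letterOf w)

letters-unique : ∀ w → Unique (letters w)
letters-unique w = deduplicate-! _≟_ (mapMaybe letterOf w)

∈-resp-εε : ∀ {a} u {v} → a ≢ ε → a ∈ u ++ ε ∷ ε ∷ v ⇔ a ∈ u ++ v
∈-resp-εε u {v} a≢ε = mk⇔ (drop-εε ∘ ∈-resp-↭ (shifts u (ε ∷ ε ∷ [])))
                          (∈-resp-↭ (↭-sym (shifts u (ε ∷ ε ∷ []))) ∘ there ∘ there)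
  where
  drop-εε : _ ∈ ε ∷ ε ∷ u ++ v → _ ∈ u ++ v
  drop-εε (here a≡ε)         = ⊥-elim (a≢ε a≡ε)
  drop-εε (there (here a≡ε)) = ⊥-elim (a≢ε a≡ε)
  drop-εε (there (there p))  = p

∈-resp-≈ : ∀ {a u v} → a ≢ ε → u ≈ v → a ∈ u ⇔ a ∈ v
∈-resp-≈ a≢ε ≈-refl           = ⇔.refl
∈-resp-≈ a≢ε (≈-sym u≈v)      = ⇔.sym (∈-resp-≈ a≢ε u≈v)
∈-resp-≈ a≢ε (≈-trans u≈t t≈v) = ⇔.trans (∈-resp-≈ a≢ε u≈t) (∈-resp-≈ a≢ε t≈v)
∈-resp-≈ a≢ε (≈-rot {x} {u})  = mk⇔ (∈-resp-↭ (∷↭∷ʳ x u)) (∈-resp-↭ (↭-sym (∷↭∷ʳ x u)))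
∈-resp-≈ a≢ε (≈-rev {u})      = mk⇔ (∈-resp-↭ (↭-sym (↭-reverse u))) (∈-resp-↭ (↭-reverse u))
∈-resp-≈ a≢ε (≈-εε {u})       = ∈-resp-εε u a≢ε

map-resp-≈ : ∀ (g : Sym → Sym) → g ε ≡ ε → ∀ {u v} → u ≈ v → map g u ≈ map g v
map-resp-≈ g gε≡ε ≈-refl            = ≈-refl
map-resp-≈ g gε≡ε (≈-sym u≈v)       = ≈-sym (map-resp-≈ g gε≡ε u≈v)
map-resp-≈ g gε≡ε (≈-trans u≈t t≈v) = ≈-trans (map-resp-≈ g gε≡ε u≈t) (map-resp-≈ g gε≡ε t≈v)
map-resp-≈ g gε≡ε (≈-rot {x} {u})   = subst (g x ∷ map g u ≈_) (sym (map-++ g u (x ∷ []))) ≈-rot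
map-resp-≈ g gε≡ε (≈-rev {u})       = subst (map g u ≈_) (sym (reverse-map g u)) ≈-rev
map-resp-≈ g gε≡ε (≈-εε {u} {v})
  rewrite map-++ g u (ε ∷ ε ∷ v) | map-++ g u v | gε≡ε = ≈-εε

SameEdges : ∀ {n} → Graph n → Graph n → Set
SameEdges H K = ∀ u v → H u v ⇔ K u v

module _ {n} {H K : Graph n} (H≐K : SameEdges H K) where

  inscribed-resp : ∀ {C} → Inscribed H C → Inscribed K C
  inscribed-resp ((clique , maximal) , size) =
    ((λ u v u∈ v∈ u≢v → to (H≐K u v) (clique u v u∈ v∈ u≢v)) ,
     (λ v v∉ adjacent → maximal v v∉ (λ u u∈ → from (H≐K u v) (adjacent u u∈)))) ,
    size

module _ {n} {H K : Graph n} (H≐K : SameEdges H K) (f : Fin n → Fin n) where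

  private
    K⇒H : ∀ {C} → Inscribed K C → Inscribed H C
    K⇒H = inscribed-resp (λ u v → ⇔.sym (H≐K u v))

    rimPath-resp : ∀ {i k} → RimPath K f i k → RimPath H f i k
    rimPath-resp (1≤k , k<n , interior) =
      1≤k , k<n , λ j 1≤j j<k C → interior j 1≤j j<k C ∘ inscribed-resp H≐K

  nConditions-resp : NConditions H f → NConditions K f
  nConditions-resp (n1 , n2 , (ξ , (ξ∈ , disjoint) , n4) , n5) =
    (λ A A-ins i k → n1 A (K⇒H A-ins) i k ∘ rimPath-resp) ,
    (λ A → n2 A ∘ K⇒H) ,
    (ξ , ((λ A → ξ∈ A ∘ K⇒H) , (λ A B A-ins B-ins → disjoint A B (K⇒H A-ins) (K⇒H B-ins))) ,
         (λ A A-ins i k → n4 A (K⇒H A-ins) i k ∘ rimPath-resp)) ,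
    (λ A B A-ins B-ins A≢B i k → n5 A B (K⇒H A-ins) (K⇒H B-ins) A≢B i k ∘ rimPath-resp)

TwoMembers : ∀ {n} → Subset n → Set
TwoMembers C = ∃₂ λ u v → u ∈ₛ C × v ∈ₛ C × u ≢ v

twoMembers-other : ∀ {n} {C : Subset n} → TwoMembers C → ∀ u → ∃[ c ] (c ∈ₛ C × c ≢ u)
twoMembers-other (a , b , a∈ , b∈ , a≢b) u with a FinP.≟ u
... | yes refl = b , b∈ , a≢b ∘ sym
... | no a≢u   = a , a∈ , a≢u

maxClique-twoMembers : ∀ {n} {H : Graph n} {C} → Fin n → (∀ u → ∃ (H u)) → (∀ u → ¬ H u u) →
                       IsMaxClique H C → TwoMembers C
maxClique-twoMembers {H = H} {C} v₀ neighbour irreflexive (_ , maximal)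
  with FinP.any? (SubsetP._∈? C)
... | no empty = ⊥-elim (maximal v₀ (λ v₀∈ → empty (v₀ , v₀∈)) (λ u u∈ → ⊥-elim (empty (u , u∈))))
... | yes (u , u∈) with FinP.any? (λ v → (v SubsetP.∈? C) ×-dec ¬? (v FinP.≟ u))
...   | yes (v , v∈ , v≢u) = u , v , u∈ , v∈ , v≢u ∘ sym
...   | no noOther = ⊥-elim (maximal w w∉ (λ x x∈ → subst (λ t → H t w) (sym (only x∈)) Huw))
  where
  w   = proj₁ (neighbour u)
  Huw = proj₂ (neighbour u)
  only : ∀ {x} → x ∈ₛ C → x ≡ u
  only {x} x∈ = decidable-stable (x FinP.≟ u) (λ x≢u → noOther (x , x∈ , x≢u))
  w∉ : w ∉ₛ C
  w∉ w∈ = irreflexive u (subst (H u) (only w∈) Huw)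

¬¬-∀-Fin : ∀ {n} {P : Fin n → Set} → (∀ i → ¬ ¬ P i) → ¬ ¬ (∀ i → P i)
¬¬-∀-Fin {zero}  ¬¬P ¬∀P = ¬∀P (λ ())
¬¬-∀-Fin {suc n} ¬¬P ¬∀P =
  ¬¬P zero (λ P₀ → ¬¬-∀-Fin (¬¬P ∘ suc) (λ P₊ → ¬∀P λ { zero → P₀ ; (suc i) → P₊ i }))

module _ {n} {G : Graph n} (diamondFree : DiamondFree G) where

  maxClique-noExternalCommonNeighbour : ∀ {X u v c} → IsMaxClique G X → u ∈ₛ X → v ∈ₛ X → u ≢ v →
                                        c ∉ₛ X → G u c → G v c → ⊥
  maxClique-noExternalCommonNeighbour {X} {u} {v} {c} (clique , maximal) u∈ v∈ u≢v c∉ Guc Gvc =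
    ¬¬-∀-Fin adjacent (maximal c c∉)
    where
    c≢ : ∀ {x} → x ∈ₛ X → x ≢ c
    c≢ x∈ refl = c∉ x∈
    -- a member x of X not adjacent to c would make u, v, x, c a diamond; adjacency
    -- being undecidable, this yields adjacency of x only up to double negation
    adjacent : ∀ x → ¬ ¬ (x ∈ₛ X → G x c)
    adjacent x ¬adj with x FinP.≟ u | x FinP.≟ v | x SubsetP.∈? X
    ... | yes refl | _        | _      = ¬adj (λ _ → Guc)
    ... | no _     | yes refl | _      = ¬adj (λ _ → Gvc)
    ... | no _     | no _     | no x∉  = ¬adj (⊥-elim ∘ x∉)
    ... | no x≢u   | no x≢v   | yes x∈ =
      diamondFree (u , v , x , c , u≢v , x≢u ∘ sym , c≢ u∈ , x≢v ∘ sym , c≢ v∈ , c≢ x∈ ,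
        clique u v u∈ v∈ u≢v , clique u x u∈ x∈ (x≢u ∘ sym) , Guc ,
        clique v x v∈ x∈ (x≢v ∘ sym) , Gvc , λ Gxc → ¬adj (λ _ → Gxc))

  maxCliques-sharingEdge-≡ : ∀ {A B u v} → IsMaxClique G A → IsMaxClique G B →
                             u ∈ₛ A → u ∈ₛ B → v ∈ₛ A → v ∈ₛ B → u ≢ v → A ≡ B
  maxCliques-sharingEdge-≡ {u = u} {v} A-max B-max uA uB vA vB u≢v =
    SubsetP.⊆-antisym (included A-max B-max uA uB vA vB) (included B-max A-max uB uA vB vA)
    where
    included : ∀ {A B} → IsMaxClique G A → IsMaxClique G B →
               u ∈ₛ A → u ∈ₛ B → v ∈ₛ A → v ∈ₛ B → A ⊆ₛ B
    included {A} {B} (A-clique , _) B-max uA uB vA vB {c} cA with c SubsetP.∈? B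
    ... | yes cB = cB
    ... | no c∉B = ⊥-elim (maxClique-noExternalCommonNeighbour B-max uB vB u≢v c∉B
                    (A-clique _ c uA cA λ { refl → c∉B uB }) (A-clique _ c vA cA λ { refl → c∉B vB }))

[i+1]%n≢i : ∀ {m i} → i < suc m → 2 ≤ suc m → (i + 1) % suc m ≢ i
[i+1]%n≢i {m} {i} i<n 2≤n [i+1]%n≡i with i + 1 <? suc m
... | yes i+1<n = 1+n≢n (trans (+-comm 1 i) (trans (sym (m<n⇒m%n≡m i+1<n)) [i+1]%n≡i))
... | no i+1≮n  = <-irrefl refl (subst (2 ≤_) (sym 1≡n) 2≤n)
  where
  i+1≡n : i + 1 ≡ suc m
  i+1≡n = ≤-antisym (subst (_≤ suc m) (+-comm 1 i) i<n) (≮⇒≥ i+1≮n)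
  i≡0 : i ≡ 0
  i≡0 = trans (sym [i+1]%n≡i) (trans (cong (_% suc m) i+1≡n) (n%n≡0 (suc m)))
  1≡n : 1 ≡ suc m
  1≡n = subst (λ t → t + 1 ≡ suc m) i≡0 i+1≡n

shift-1≢ : ∀ {n} (i : Fin n) → 2 ≤ n → shift i 1 ≢ i
shift-1≢ {suc m} i 2≤n shift≡i =
  [i+1]%n≢i (FinP.toℕ<n i) 2≤n (trans (sym (FinP.toℕ-fromℕ< _)) (cong toℕ shift≡i))

module MultisunProperties {n} {G : Graph n} {f : Fin n → Fin n} (M : Multisun G f) where
  open Multisun M

  f-injective : ∀ {i j} → f i ≡ f j → i ≡ j
  f-injective = proj₁ f-bij

  f-surjective : ∀ v → ∃[ i ] f i ≡ v
  f-surjective v with proj₂ f-bij v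
  ... | i , fi≡v = i , fi≡v refl

  rimEdge : ∀ i → G (f i) (f (shift i 1))
  rimEdge i = proj₁ (rim₂ i) (f i) (f (shift i 1))
    (SubsetP.x∈p∪q⁺ (inj₁ (SubsetP.x∈⁅x⁆ _))) (SubsetP.x∈p∪q⁺ (inj₂ (SubsetP.x∈⁅x⁆ _)))
    (shift-1≢ i (m+n≤o⇒n≤o 1 three≤n) ∘ sym ∘ f-injective)

  rim-maxClique-twoMembers : ∀ {H : Graph n} {C} → (∀ i → H (f i) (f (shift i 1))) →
                             (∀ u → ¬ H u u) → IsMaxClique H C → TwoMembers C
  rim-maxClique-twoMembers {H} rim = maxClique-twoMembers (fromℕ< (m+n≤o⇒n≤o 2 three≤n)) neighbour
    where
    neighbour : ∀ u → ∃ (H u)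
    neighbour u with f-surjective u
    ... | i , refl = f (shift i 1) , rim i

sunoid-nConditions : ∀ {n} {G : Graph n} {f : Fin n → Fin n} → Sunoid G f →
                     ∀ {A} → Inscribed G A → NConditions G f
sunoid-nConditions {f = f} S {A} A-ins =
  nConditions-resp (λ u v → mk⇔ proj₁ (λ Guv → Guv , λ ())) f (Sunoid.subN S [] [] (A , A-ins , λ ()))

module Deletion {n} {G : Graph n} {f : Fin n → Fin n} (S : Sunoid G f)
                (D : List (Subset n)) (D-inscribed : All (Inscribed G) D) where
  open Sunoid S using (multisun; subN)
  open Multisun multisun
  open MultisunProperties multisun

  G′ : Graph n
  G′ = deleteCliques G D

  private
    deleted-maxClique : ∀ {X} → X ∈ D → IsMaxClique G X
    deleted-maxClique = proj₁ ∘ All.lookup D-inscribed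

  rimEdge′ : ∀ i → G′ (f i) (f (shift i 1))
  rimEdge′ i = rimEdge i , λ shared → let (X , X∈D , both) = find shared in
                                       nonconsec X (All.lookup D-inscribed X∈D) i both

  maxClique′-twoMembers : ∀ {C} → IsMaxClique G′ C → TwoMembers C
  maxClique′-twoMembers = rim-maxClique-twoMembers rimEdge′ (λ u → irreflexive u ∘ proj₁)

  maxClique′⇒maxClique : ∀ {C} → IsMaxClique G′ C → IsMaxClique G C
  maxClique′⇒maxClique {C} C-max′@(clique′ , maximal′) = (λ u v u∈ v∈ → proj₁ ∘ clique′ u v u∈ v∈) , maximal
    where
    maximal : ∀ v → v ∉ₛ C → ¬ (∀ u → u ∈ₛ C → G u v)
    maximal v v∉ adjacent = maximal′ v v∉ λ u u∈ → adjacent u u∈ , notShared u u∈ ∘ find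
      where
      -- another member c of C is adjacent to u in G′, so c ∉ X, yet c is a common neighbour of u, v ∈ X
      notShared : ∀ u → u ∈ₛ C → ¬ (∃ λ X → X ∈ D × u ∈ₛ X × v ∈ₛ X)
      notShared u u∈ (X , X∈D , uX , vX) with twoMembers-other (maxClique′-twoMembers C-max′) u
      ... | c , c∈ , c≢u with clique′ u c u∈ c∈ (c≢u ∘ sym) | c SubsetP.∈? X
      ... | _   , unshared | yes cX = unshared (lose X∈D (uX , cX))
      ... | Guc , _        | no c∉X = maxClique-noExternalCommonNeighbour diamondFree
            (deleted-maxClique X∈D) uX vX (λ { refl → v∉ u∈ }) c∉X Guc (symmetric c v (adjacent c c∈))

  inscribed′⇒inscribed : ∀ {C} → Inscribed G′ C → Inscribed G C × C ∉ D
  inscribed′⇒inscribed {C} (C-max′ , size) = (maxClique′⇒maxClique C-max′ , size) , notDeleted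
    where
    notDeleted : C ∉ D
    notDeleted C∈D with maxClique′-twoMembers C-max′
    ... | a , b , a∈ , b∈ , a≢b = proj₂ (proj₁ C-max′ a b a∈ b∈ a≢b) (lose C∈D (a∈ , b∈))

  maxClique⇒maxClique′ : ∀ {C} → IsMaxClique G C →
                         (∀ u v → u ∈ₛ C → v ∈ₛ C → u ≢ v → ¬ Any (λ X → u ∈ₛ X × v ∈ₛ X) D) →
                         IsMaxClique G′ C
  maxClique⇒maxClique′ (clique , maximal) unshared =
    (λ u v u∈ v∈ u≢v → clique u v u∈ v∈ u≢v , unshared u v u∈ v∈ u≢v) ,
    λ v v∉ adjacent′ → maximal v v∉ (λ u → proj₁ ∘ adjacent′ u)

  inscribed⇒inscribed′ : ∀ {C} → Inscribed G C → C ∉ D → Inscribed G′ C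
  inscribed⇒inscribed′ {C} (C-max , size) C∉D = maxClique⇒maxClique′ C-max unshared , size
    where
    unshared : ∀ u v → u ∈ₛ C → v ∈ₛ C → u ≢ v → ¬ Any (λ X → u ∈ₛ X × v ∈ₛ X) D
    unshared u v u∈ v∈ u≢v shared with find shared
    ... | X , X∈D , uX , vX =
      C∉D (lose X∈D (maxCliques-sharingEdge-≡ diamondFree C-max (deleted-maxClique X∈D) u∈ uX v∈ vX u≢v))

  diamondFree′ : DiamondFree G′
  diamondFree′ (a , b , c , d , a≢b , a≢c , a≢d , b≢c , b≢d , c≢d , Gab , Gac , Gad , Gbc , Gbd , ¬Gcd) =
    diamondFree (a , b , c , d , a≢b , a≢c , a≢d , b≢c , b≢d , c≢d ,
                 proj₁ Gab , proj₁ Gac , proj₁ Gad , proj₁ Gbc , proj₁ Gbd , ¬Gcd-in-G)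
    where
    -- a common neighbour of c and d lies in every deleted clique containing both, yet ac survives
    ¬Gcd-in-G : ¬ G c d
    ¬Gcd-in-G Gcd with Any.any? (λ X → (c SubsetP.∈? X) ×-dec (d SubsetP.∈? X)) D
    ... | no unshared = ¬Gcd (Gcd , unshared)
    ... | yes shared with find shared
    ...   | X , X∈D , cX , dX with a SubsetP.∈? X
    ...     | yes aX = proj₂ Gac (lose X∈D (aX , cX))
    ...     | no a∉X = maxClique-noExternalCommonNeighbour diamondFree (deleted-maxClique X∈D) cX dX c≢d a∉X
                         (symmetric a c (proj₁ Gac)) (symmetric a d (proj₁ Gad))

  rim₂′ : ∀ i → IsMaxClique G′ (⁅ f i ⁆ ∪ ⁅ f (shift i 1) ⁆)
  rim₂′ i = maxClique⇒maxClique′ (rim₂ i) unshared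
    where
    P = ⁅ f i ⁆
    Q = ⁅ f (shift i 1) ⁆
    at : ∀ {x y} → x ∈ₛ ⁅ y ⁆ → x ≡ y
    at = SubsetP.x∈⁅y⁆⇒x≡y _
    unshared : ∀ u v → u ∈ₛ P ∪ Q → v ∈ₛ P ∪ Q → u ≢ v → ¬ Any (λ X → u ∈ₛ X × v ∈ₛ X) D
    unshared u v u∈ v∈ u≢v shared
      with find shared | SubsetP.x∈p∪q⁻ P Q u∈ | SubsetP.x∈p∪q⁻ P Q v∈
    ... | _ , _ , _ , _       | inj₁ uP | inj₁ vP = u≢v (trans (at uP) (sym (at vP)))
    ... | _ , _ , _ , _       | inj₂ uQ | inj₂ vQ = u≢v (trans (at uQ) (sym (at vQ)))
    ... | X , X∈D , uX , vX | inj₁ uP | inj₂ vQ = nonconsec X (All.lookup D-inscribed X∈D) i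
                                                   (subst (_∈ₛ X) (at uP) uX , subst (_∈ₛ X) (at vQ) vX)
    ... | X , X∈D , uX , vX | inj₂ uQ | inj₁ vP = nonconsec X (All.lookup D-inscribed X∈D) i
                                                   (subst (_∈ₛ X) (at vP) vX , subst (_∈ₛ X) (at uQ) uX)

  multisun′ : Multisun G′ f
  multisun′ = record
    { odd-order   = odd-order
    ; three≤n     = three≤n
    ; symmetric   = λ u v Guv → symmetric u v (proj₁ Guv) ,
                                proj₂ Guv ∘ Any.map (λ { (vX , uX) → uX , vX })
    ; irreflexive = λ u → irreflexive u ∘ proj₁
    ; diamondFree = diamondFree′
    ; f-bij       = f-bij
    ; rim₁        = λ C → rim₁ C ∘ maxClique′⇒maxClique
    ; rim₂        = rim₂′
    ; nonconsec   = λ C → nonconsec C ∘ proj₁ ∘ inscribed′⇒inscribed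
    }

  deleteCliques-++ : ∀ ds → SameEdges (deleteCliques G (D ++ ds)) (deleteCliques G′ ds)
  deleteCliques-++ ds u v =
    mk⇔ (λ { (Guv , unshared) → (Guv , unshared ∘ ++⁺ˡ) , unshared ∘ ++⁺ʳ D })
        (λ { ((Guv , unsharedᴰ) , unshared) → Guv , [ unsharedᴰ , unshared ]′ ∘ ++⁻ D })

  sunoid′ : Sunoid G′ f
  sunoid′ = record { multisun = multisun′ ; subN = subN′ }
    where
    subN′ : ∀ ds → All (Inscribed G′) ds → ∃[ C ] (Inscribed G′ C × C ∉ ds) →
            NConditions (deleteCliques G′ ds) f
    subN′ ds ds-inscribed (C , C-ins′ , C∉ds) =
      nConditions-resp (deleteCliques-++ ds) f
        (subN (D ++ ds) (++⁺ D-inscribed (All.map (proj₁ ∘ inscribed′⇒inscribed) ds-inscribed))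
              (C , C-ins , [ C∉D , C∉ds ]′ ∘ ++⁻ D))
      where
      C-ins = proj₁ (inscribed′⇒inscribed C-ins′)
      C∉D   = proj₂ (inscribed′⇒inscribed C-ins′)

Survives : List Sym → List ℕ → ℕ → Set
Survives w xs y = y ∈ letters w × y ∉ xs

data ValidSigmaImage (w : List Sym) (xs : List ℕ) : Sym → Set where
  several : ∀ {y z} → y ≢ z → Survives w xs y → Survives w xs z → ValidSigmaImage w xs σ
  single  : ∀ {y} → Survives w xs y → (∀ {z} → Survives w xs z → z ≡ y) → ValidSigmaImage w xs (ltr y)

module _ {w : List Sym} {xs : List ℕ} where

  survives? : ∀ y → Dec (y ∉ xs)
  survives? y = ¬? (y ∈? xs)

  survivor : length xs < numLetters w → ∃ (Survives w xs)
  survivor = unique-longer⇒∃∉ _≟_ (letters-unique w) xs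

  σ-valid : length xs < numLetters w → suc (length xs) ≢ numLetters w → ValidSigmaImage w xs σ
  σ-valid q<p q+1≢p with survivor q<p
  ... | y , y-survives with unique-longer⇒∃∉ _≟_ (letters-unique w) (y ∷ xs) (≤∧≢⇒< q<p q+1≢p)
  ... | z , z∈ , z∉y∷xs = several (λ y≡z → z∉y∷xs (here (sym y≡z))) y-survives (z∈ , z∉y∷xs ∘ there)

  survivor-unique : Unique xs → All (λ x → ltr x ∈ w) xs → suc (length xs) ≡ numLetters w →
                    ∀ {y z} → Survives w xs y → Survives w xs z → z ≡ y
  -- otherwise z, y and the letters of xs would be more than numLetters w distinct letters of w
  survivor-unique xs! xs-occur q+1≡p {y} {z} (y∈ , y∉) (z∈ , z∉) with z ≟ y
  ... | yes z≡y = z≡y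
  ... | no z≢y with unique-longer⇒∃∉ _≟_ ((z≢y ∷ ¬Any⇒All¬ xs z∉) ∷ ¬Any⇒All¬ xs y∉ ∷ xs!) (letters w)
                      (subst (_< suc (suc (length xs))) q+1≡p (n<1+n _))
  ... | _ , here refl            , ∉letters = ⊥-elim (∉letters z∈)
  ... | _ , there (here refl)    , ∉letters = ⊥-elim (∉letters y∈)
  ... | _ , there (there x∈xs) , ∉letters = ⊥-elim (∉letters (∈-letters⁺ w (All.lookup xs-occur x∈xs)))

  sigmaImage-valid : Unique xs → All (λ x → ltr x ∈ w) xs →
                     length xs < numLetters w → suc (length xs) ≡ numLetters w →
                     ValidSigmaImage w xs (sigmaImage (filter survives? (letters w)))
  sigmaImage-valid xs! xs-occur q<p q+1≡p with filter survives? (letters w) in survivors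
  ... | [] = let (y , y∈ , y∉) = survivor q<p in
             case subst (y ∈_) survivors (∈-filter⁺ survives? y∈ y∉) of λ ()
  ... | y ∷ _ = single y-survives (survivor-unique xs! xs-occur q+1≡p y-survives)
    where
    y-survives = ∈-filter⁻ survives? (subst (y ∈_) (sym survivors) (here refl))

module Realisation {w : List Sym} {n} {G : Graph n} {f : Fin n → Fin n} {ℓ : Subset n → ℕ}
  {r : Vec Sym n} (S : Sunoid G f)
  (ℓ-injective : ∀ A B → Inscribed G A → Inscribed G B → ℓ A ≡ ℓ B → A ≡ B)
  (label : ∀ i → Label G ℓ (f i) (lookup r i))
  (r≈w : toList r ≈ w) where
  open Sunoid S using (multisun)
  open Multisun multisun using (irreflexive)
  open MultisunProperties multisun

  ltr∈r⇔ltr∈w : ∀ {x} → ltr x ∈ toList r ⇔ ltr x ∈ w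
  ltr∈r⇔ltr∈w = ∈-resp-≈ (λ ()) r≈w

  cliqueOf : ∀ {x} → ltr x ∈ w → ∃[ X ] (Inscribed G X × ℓ X ≡ x)
  cliqueOf x∈w = labelClique (subst (Label G ℓ _) (sym (lookup-index x∈r)) (label (index x∈r)))
    where
    x∈r = ∈-toList⁻ (from ltr∈r⇔ltr∈w x∈w)
    labelClique : ∀ {v x} → Label G ℓ v (ltr x) → ∃[ X ] (Inscribed G X × ℓ X ≡ x)
    labelClique (lx X X-ins _ _) = X , X-ins , refl

  -- a member of Z other than the common vertex ξ lies in no other clique, so it is labelled ℓ Z
  clique-letter∈w : ∀ {Z} → Inscribed G Z → ltr (ℓ Z) ∈ w
  clique-letter∈w {Z} Z-ins with sunoid-nConditions S Z-ins
  ... | _ , _ , (ξ , (_ , disjoint) , _) , _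
    with twoMembers-other (rim-maxClique-twoMembers rimEdge irreflexive (proj₁ Z-ins)) ξ
  ... | c , c∈Z , c≢ξ with f-surjective c
  ... | i , refl = to ltr∈r⇔ltr∈w (∈-toList⁺ (subst (_∈ᵥ r) (privateLabel (label i)) (∈-lookup i r)))
    where
    privateLabel : ∀ {t} → Label G ℓ (f i) t → t ≡ ltr (ℓ Z)
    privateLabel (lσ A B A-ins B-ins A≢B fiA fiB) = ⊥-elim (c≢ξ (disjoint A B A-ins B-ins A≢B _ fiA fiB))
    privateLabel (lx X _ _ only)                   = cong (ltr ∘ ℓ) (sym (only Z Z-ins c∈Z))
    privateLabel (lε none)                         = ⊥-elim (none Z Z-ins c∈Z)

  deleted : ∀ {ys} → All (λ x → ltr x ∈ w) ys → List (Subset n)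
  deleted []           = []
  deleted (y∈w ∷ ys∈w) = proj₁ (cliqueOf y∈w) ∷ deleted ys∈w

  deleted-inscribed : ∀ {ys} (ys∈w : All (λ x → ltr x ∈ w) ys) → All (Inscribed G) (deleted ys∈w)
  deleted-inscribed []           = []
  deleted-inscribed (y∈w ∷ ys∈w) = proj₁ (proj₂ (cliqueOf y∈w)) ∷ deleted-inscribed ys∈w

  ∈-deleted⁻ : ∀ {ys} (ys∈w : All (λ x → ltr x ∈ w) ys) {X} → X ∈ deleted ys∈w → ℓ X ∈ ys
  ∈-deleted⁻ (y∈w ∷ ys∈w) (here refl) = here (proj₂ (proj₂ (cliqueOf y∈w)))
  ∈-deleted⁻ (y∈w ∷ ys∈w) (there X∈) = there (∈-deleted⁻ ys∈w X∈)

  ∈-deleted⁺ : ∀ {ys} (ys∈w : All (λ x → ltr x ∈ w) ys) {X} → Inscribed G X → ℓ X ∈ ys →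
               X ∈ deleted ys∈w
  ∈-deleted⁺ (y∈w ∷ ys∈w) {X} X-ins (here ℓX≡y) with cliqueOf y∈w
  ... | Y , Y-ins , ℓY≡y = here (ℓ-injective X Y X-ins Y-ins (trans ℓX≡y (sym ℓY≡y)))
  ∈-deleted⁺ (y∈w ∷ ys∈w) X-ins (there ℓX∈) = there (∈-deleted⁺ ys∈w X-ins ℓX∈)

  module Projection {xs : List ℕ} {s : Sym}
                    (xs-occur : All (λ x → ltr x ∈ w) xs) (s-valid : ValidSigmaImage w xs s) where
    open Deletion S (deleted xs-occur) (deleted-inscribed xs-occur)

    surviving⇒inscribed′ : ∀ {X} → Inscribed G X → ℓ X ∉ xs → Inscribed G′ X
    surviving⇒inscribed′ X-ins ℓX∉xs = inscribed⇒inscribed′ X-ins (ℓX∉xs ∘ ∈-deleted⁻ xs-occur)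

    inscribed′⇒survives : ∀ {Z} → Inscribed G′ Z → Survives w xs (ℓ Z)
    inscribed′⇒survives Z-ins′ with inscribed′⇒inscribed Z-ins′
    ... | Z-ins , Z∉D = ∈-letters⁺ w (clique-letter∈w Z-ins) , Z∉D ∘ ∈-deleted⁺ xs-occur Z-ins

    survivorClique : ∀ {y} → Survives w xs y → ∃[ Y ] (Inscribed G′ Y × ℓ Y ≡ y)
    survivorClique (y∈ , y∉) with cliqueOf (∈-letters⁻ w y∈)
    ... | Y , Y-ins , refl = Y , surviving⇒inscribed′ Y-ins y∉ , refl

    ℓ-injective′ : ∀ A B → Inscribed G′ A → Inscribed G′ B → ℓ A ≡ ℓ B → A ≡ B
    ℓ-injective′ A B A-ins′ B-ins′ =
      ℓ-injective A B (proj₁ (inscribed′⇒inscribed A-ins′)) (proj₁ (inscribed′⇒inscribed B-ins′))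

    -- a vertex in two cliques is ξ, which lies in every clique of G′
    σ-label : ∀ {v} A B → Inscribed G A → Inscribed G B → A ≢ B → v ∈ₛ A → v ∈ₛ B → Label G′ ℓ v s
    σ-label {v} A B A-ins B-ins A≢B vA vB with sunoid-nConditions S A-ins
    ... | _ , _ , (ξ , (ξ∈ , disjoint) , _) , _ = ξ-label s-valid
      where
      v∈ : ∀ {Y} → Inscribed G′ Y → v ∈ₛ Y
      v∈ {Y} Y-ins′ = subst (_∈ₛ Y) (sym (disjoint A B A-ins B-ins A≢B v vA vB))
                            (ξ∈ Y (proj₁ (inscribed′⇒inscribed Y-ins′)))
      ξ-label : ∀ {s} → ValidSigmaImage w xs s → Label G′ ℓ v s
      ξ-label (several y≢z y-survives z-survives)
        with survivorClique y-survives | survivorClique z-survives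
      ... | Y , Y-ins′ , refl | Z , Z-ins′ , refl =
        lσ Y Z Y-ins′ Z-ins′ (y≢z ∘ cong ℓ) (v∈ Y-ins′) (v∈ Z-ins′)
      ξ-label (single y-survives sole) with survivorClique y-survives
      ... | Y , Y-ins′ , refl =
        lx Y Y-ins′ (v∈ Y-ins′) λ Z Z-ins′ _ → ℓ-injective′ Z Y Z-ins′ Y-ins′ (sole (inscribed′⇒survives Z-ins′))

    projectLabel : ∀ {v t} → Label G ℓ v t → Label G′ ℓ v (projSym xs s t)
    projectLabel (lε none) = lε (λ Y → none Y ∘ proj₁ ∘ inscribed′⇒inscribed)
    projectLabel (lσ A B A-ins B-ins A≢B vA vB) = σ-label A B A-ins B-ins A≢B vA vB
    projectLabel (lx X X-ins vX only) with ℓ X ∈? xs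
    ... | yes ℓX∈xs = lε λ Y Y-ins′ vY → let (Y-ins , Y∉D) = inscribed′⇒inscribed Y-ins′ in
      Y∉D (subst (_∈ deleted xs-occur) (sym (only Y Y-ins vY)) (∈-deleted⁺ xs-occur X-ins ℓX∈xs))
    ... | no ℓX∉xs = lx X (surviving⇒inscribed′ X-ins ℓX∉xs) vX (λ Y → only Y ∘ proj₁ ∘ inscribed′⇒inscribed)

    isSunword-projection : IsSunword (map (projSym xs s) w)
    isSunword-projection = n , G′ , f , ℓ , Vec.map (projSym xs s) r , sunoid′ , ℓ-injective′ ,
      (λ i → subst (Label G′ ℓ (f i)) (sym (lookup-map i _ r)) (projectLabel (label i))) ,
      subst (_≈ map (projSym xs s) w) (sym (toList-map _ r)) (map-resp-≈ _ refl r≈w)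

isSunword-map-projSym : ∀ {w xs s} → IsSunword w → All (λ x → ltr x ∈ w) xs →
                        ValidSigmaImage w xs s → IsSunword (map (projSym xs s) w)
isSunword-map-projSym (_ , _ , _ , _ , _ , S , ℓ-injective , label , r≈w) =
  Realisation.Projection.isSunword-projection S ℓ-injective label r≈w

proposition3 : (w : List Sym) → IsSunword w →
    2 ≤ numLetters w →
    (xs : List ℕ) → Unique xs → All (λ x → ltr x ∈ w) xs →
    length xs < numLetters w →
    IsSunword (project w xs)
proposition3 w w-sunword _ xs xs! xs-occur q<p with suc (length xs) ≟ numLetters w
... | yes q+1≡p = isSunword-map-projSym w-sunword xs-occur (sigmaImage-valid xs! xs-occur q<p q+1≡p)
... | no  q+1≢p = isSunword-map-projSym w-sunword xs-occur (σ-valid q<p q+1≢p)
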